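{- Let $\mathcal{M}=\langle S,N,V\rangle$ be a neighborhood model and $c(\mathcal{M})=\langle S,cN,V\rangle$ its $c$-variation. Then for all $\phi\in\mathcal{L}_\Delta$ and all $s\in S$, $\mathcal{M},s\Vdash\phi$ iff $c(\mathcal{M}),s\Vvdash\phi$.
   Context: $\mathcal{L}_\Delta$: $\phi::=p\mid\neg\phi\mid(\phi\land\phi)\mid\Delta\phi$. A neighborhood model is $\langle S,N,V\rangle$, $S\neq\emptyset$, $N:S\to 2^{2^S}$. The $c$-variation of $\mathcal{M}$ is $c(\mathcal{M})=\langle S,cN,V\rangle$ with $cN(s)=\{X\subseteq S: X\in N(s)\text{ or }S\setminus X\in N(s)\}$. Both semantics: atoms via $V$, Boolean clauses standard. New semantics: $\mathcal{M},s\Vvdash\Delta\phi$ iff $\{t:\mathcal{M},t\Vvdash\phi\}\in N(s)$. Old semantics: $\mathcal{M},s\Vdash\Delta\phi$ iff $\{t:\mathcal{M},t\Vdash\phi\}\in N(s)$ or $\{t:\mathcal{M},t\Vdash\neg\phi\}\in N(s)$. -}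

module Defs where

open import Data.Bool using (Bool; true; false; not; _∧_; _∨_)
open import Data.Nat using (ℕ)
open import Relation.Binary.PropositionalEquality using (_≡_; cong; cong₂)

Prop : Set
Prop = ℕ

data Form : Set where
  var  : Prop → Form
  ¬′_  : Form → Form
  _∧′_ : Form → Form → Form
  Δ_   : Form → Form

-- Subsets of S are represented (classically) by characteristic functions.
Subset : Set → Set
Subset S = S → Bool

compl : {S : Set} → Subset S → Subset S
compl X t = not (X t)

-- N(s) ⊆ 2^S is given by its
-- characteristic function on subsets; N-ext says N(s) is a family of *sets*,
-- i.e. pointwise-equal characteristic functions denote the same subset.
-- S is nonempty (witnessed by point).
record NbhdModel : Set₁ where
  field
    S     : Set
    point : S
    N     : S → Subset S → Bool
    N-ext : ∀ s (X Y : Subset S) → (∀ t → X t ≡ Y t) → N s X ≡ N s Y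
    V     : Prop → Subset S

cvar : NbhdModel → NbhdModel
cvar M = record
  { S = S ; point = point
  ; N = λ s X → N s X ∨ N s (compl X)
  ; N-ext = λ s X Y eq →
      cong₂ _∨_ (N-ext s X Y eq) (N-ext s (compl X) (compl Y) (λ t → cong not (eq t)))
  ; V = V }
  where open NbhdModel M

-- Old semantics:  old M φ s = true  iff  M , s ⊩ φ
old : (M : NbhdModel) → Form → Subset (NbhdModel.S M)
old M (var p)  s = NbhdModel.V M p s
old M (¬′ φ)   s = not (old M φ s)
old M (φ ∧′ ψ) s = old M φ s ∧ old M ψ s
old M (Δ φ)    s = NbhdModel.N M s (old M φ) ∨ NbhdModel.N M s (λ t → not (old M φ t))

-- New semantics:  new M φ s = true  iff  M , s ⊩⊩ φ
new : (M : NbhdModel) → Form → Subset (NbhdModel.S M)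
new M (var p)  s = NbhdModel.V M p s
new M (¬′ φ)   s = not (new M φ s)
new M (φ ∧′ ψ) s = new M φ s ∧ new M ψ s
new M (Δ φ)    s = NbhdModel.N M s (new M φ)

module Submission where

open import Data.Bool using (true; not; _∧_; _∨_)
open import Function.Bundles using (_⇔_; mk⇔)
open import Relation.Binary.PropositionalEquality using (_≡_; refl; cong; cong₂; sym; trans)

open import Defs

-- At Δφ the old clause "‖φ‖ ∈ N(s) or ‖¬φ‖ ∈ N(s)" is literally membership of ‖φ‖
-- in cN(s); the induction hypothesis is carried inside N by its extensionality.
old≗new-cvar : (M : NbhdModel) (φ : Form) (s : NbhdModel.S M) →
               old M φ s ≡ new (cvar M) φ s
old≗new-cvar M (var p)  s = refl
old≗new-cvar M (¬′ φ)   s = cong not (old≗new-cvar M φ s)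
old≗new-cvar M (φ ∧′ ψ) s = cong₂ _∧_ (old≗new-cvar M φ s) (old≗new-cvar M ψ s)
old≗new-cvar M (Δ φ)    s = cong₂ _∨_
  (N-ext s (old M φ) (new (cvar M) φ) (old≗new-cvar M φ))
  (N-ext s (compl (old M φ)) (compl (new (cvar M) φ)) (λ t → cong not (old≗new-cvar M φ t)))
  where open NbhdModel M

proposition3 : (M : NbhdModel) (φ : Form) (s : NbhdModel.S M) →
    (old M φ s ≡ true) ⇔ (new (cvar M) φ s ≡ true)
proposition3 M φ s = mk⇔ (trans (sym old≡new)) (trans old≡new)
  where
  old≡new : old M φ s ≡ new (cvar M) φ s
  old≡new = old≗new-cvar M φ s
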